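{- Let $k\geq 3$ and let $A$ be a finite abelian group with at least $k$ elements. Let $S_1,\ldots,S_l$ be a distinct difference system in $A$. Call a subset of $A$ a basis if it has exactly $k$ elements and is not a translate $\{s+a\mid s\in T\}$ ($a\in A$) of a subset $T$ of some $S_i$. Then these bases are the bases of a simple rank $k$ matroid on $A$ which is $A$-invariant (i.e. every translate of a basis is a basis).
   Context: Subsets $S_1,\ldots,S_l$ of an abelian group $A$ form a distinct difference system if: (i) for any $i,j$ and any $x,y\in S_i$, $z,w\in S_j$ with $x\neq y$ and $z\neq w$, the equation $x-y=z-w$ implies $x=z$ and $y=w$; (ii) each $S_i$ contains $0$ and at least one other element; (iii) $S_i\cap S_j=\{0\}$ for all $i\neq j$. A matroid is simple if every circuit has at least three elements. -}

module Defs where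

open import Data.Nat using (ℕ; _≤_)
open import Data.Fin using (Fin)
open import Data.Fin.Subset using (Subset; _∈_; _∉_; _⊆_; _⊂_; _∪_; _-_; ⁅_⁆; ∣_∣)
open import Data.Product using (Σ; _×_; ∃; ∃-syntax)
open import Data.Empty using (⊥)
open import Relation.Nullary using (¬_)
open import Relation.Binary.PropositionalEquality using (_≡_; _≢_)
open import Function.Bundles using (_⇔_)
open import Algebra.Core using (Op₁; Op₂)
open import Level using (0ℓ; suc)

-- A finite abelian group is modelled (up to isomorphism) as an abelian group
-- structure on Fin n with propositional equality; subsets are Data.Fin.Subset.

IsTranslateOf : ∀ {n} → Op₂ (Fin n) → Subset n → Fin n → Subset n → Set
IsTranslateOf _+_ Y a T = ∀ y → (y ∈ Y) ⇔ (∃[ s ] (s ∈ T × y ≡ s + a))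

IsDistinctDifferenceSystem : ∀ {n l} → Op₂ (Fin n) → Fin n → Op₁ (Fin n) →
                             (Fin l → Subset n) → Set
IsDistinctDifferenceSystem {n} {l} _+_ 0# -_ S =
  (∀ (i j : Fin l) (x y z w : Fin n) → x ∈ S i → y ∈ S i → z ∈ S j → w ∈ S j →
     x ≢ y → z ≢ w → x + (- y) ≡ z + (- w) → x ≡ z × y ≡ w)
  × (∀ (i : Fin l) → 0# ∈ S i × ∃[ x ] (x ∈ S i × x ≢ 0#))
  × (∀ (i j : Fin l) → i ≢ j → ∀ x → x ∈ S i → x ∈ S j → x ≡ 0#)

IsDDSBasis : ∀ {n l} → Op₂ (Fin n) → (Fin l → Subset n) → ℕ → Subset n → Set
IsDDSBasis _+_ S k X =
  ∣ X ∣ ≡ k × ¬ (∃[ i ] ∃[ a ] ∃[ T ] (T ⊆ S i × IsTranslateOf _+_ X a T))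

IsMatroidBases : ∀ {n} → (Subset n → Set) → Set
IsMatroidBases {n} 𝓑 =
  (∃[ B ] 𝓑 B)
  × (∀ B₁ B₂ x → 𝓑 B₁ → 𝓑 B₂ → x ∈ B₁ → x ∉ B₂ →
       ∃[ y ] (y ∈ B₂ × y ∉ B₁ × 𝓑 ((B₁ - x) ∪ ⁅ y ⁆)))

Independent : ∀ {n} → (Subset n → Set) → Subset n → Set
Independent 𝓑 X = ∃[ B ] (𝓑 B × X ⊆ B)

IsCircuit : ∀ {n} → (Subset n → Set) → Subset n → Set
IsCircuit 𝓑 C = ¬ Independent 𝓑 C × (∀ D → D ⊂ C → Independent 𝓑 D)

HasRank : ∀ {n} → (Subset n → Set) → ℕ → Set
HasRank 𝓑 k = ∀ B → 𝓑 B → ∣ B ∣ ≡ k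

IsSimple : ∀ {n} → (Subset n → Set) → Set
IsSimple 𝓑 = ∀ C → IsCircuit 𝓑 C → 3 ≤ ∣ C ∣

IsTranslationInvariant : ∀ {n} → Op₂ (Fin n) → (Subset n → Set) → Set
IsTranslationInvariant _+_ 𝓑 = ∀ B a Y → 𝓑 B → IsTranslateOf _+_ Y a B → 𝓑 Y

{-# OPTIONS --safe #-}
-- Two distinct points x ≠ y of A lie in at most one translate S i + a: the
-- differences (x - a) - (y - a) = x - y computed in S i and in S j coincide,
-- so the distinct difference property forces a = b, and then i = j because
-- blocks only meet in 0.  Moreover no translate of a block is all of A, since
-- 0, g, 2g ∈ S i would repeat the difference g.  Hence if a k-set minus a point
-- (which keeps k - 1 ≥ 2 points) lies in S i + a, adding any point outside
-- S i + a yields a basis.  This gives basis exchange and extends every set of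
-- at most two points to a basis, so circuits have at least three elements.
-- Translation preserves both the size of a set and whether it lies in a block
-- translate.
module Submission where

open import Defs
open import Data.Nat using (ℕ; zero; suc; _≤_; _<_; z≤n; s≤s; s≤s⁻¹; z<s)
open import Data.Nat.Properties
  using ( ≤-trans; ≤-<-trans; ≤-reflexive; <⇒≤; <⇒≱; ≰⇒>; n≤0⇒n≡0; m≤n⇒m<n∨m≡n
        ; suc-injective; 0≢1+n)
open import Data.Fin using (Fin; zero; suc)
open import Data.Fin.Properties using (any?; ¬∀⟶∃¬; _≟_)
open import Data.Fin.Subset hiding (_-_)
open import Data.Fin.Subset.Properties
open import Data.Vec using (_∷_; here; there; tabulate; lookup)
open import Data.Vec.Properties using (lookup∘tabulate; []=⇒lookup; lookup⇒[]=)
open import Data.Product using (_×_; _,_; proj₁; proj₂; ∃-syntax; ∃₂)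
open import Data.Sum using (inj₁; inj₂)
open import Function using (_∘_; const; id)
open import Function.Bundles using (_⇔_; mk⇔; Equivalence)
open import Function.Definitions using (Injective)
open import Relation.Nullary using (¬_; Dec; yes; no; contradiction)
open import Relation.Nullary.Decidable using (_→-dec_; decidable-stable)
open import Relation.Binary.PropositionalEquality
open import Algebra.Core using (Op₁; Op₂)
open import Algebra.Bundles using (AbelianGroup)
open import Algebra.Structures using (IsAbelianGroup; IsGroup)
import Algebra.Properties.AbelianGroup as AbelianGroupProperties
open import Level using (0ℓ)

open Equivalence using (to; from)

private
  variable
    n : ℕ
    p q : Subset n
    x y z : Fin n

-- Data.Fin.Subset's _-_ is opened only locally: at top level it would make the
-- section -_ in the statement of theorem3p26 ambiguous.
module Cardinality where

  open import Data.Fin.Subset using (_-_)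

  x∈p─q⇒x∉q : x ∈ p ─ q → x ∉ q
  x∈p─q⇒x∉q {p = inside  ∷ p} {q = inside  ∷ q} () here
  x∈p─q⇒x∉q {p = outside ∷ p} {q = inside  ∷ q} () here
  x∈p─q⇒x∉q {p = _ ∷ p} {q = _ ∷ q} (there x∈p─q) (there x∈q) = x∈p─q⇒x∉q x∈p─q x∈q

  x∈p-y⇒x≢y : x ∈ p - y → x ≢ y
  x∈p-y⇒x≢y x∈p-y refl = x∈p─q⇒x∉q x∈p-y (x∈⁅x⁆ _)

  x∈p-y⇒x∈p : x ∈ p - y → x ∈ p
  x∈p-y⇒x∈p {p = p} {y = y} = p─q⊆p p ⁅ y ⁆

  x∈p∧y∉p⇒x≢y : x ∈ p → y ∉ p → x ≢ y
  x∈p∧y∉p⇒x≢y x∈p y∉p refl = y∉p x∈p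

  x≢y∧x∉p-y⇒x∉p : x ≢ y → x ∉ p - y → x ∉ p
  x≢y∧x∉p-y⇒x∉p x≢y x∉p-y x∈p = x∉p-y (x∈p∧x≢y⇒x∈p-y x∈p x≢y)

  ∣p∣≡1+∣p-x∣ : x ∈ p → ∣ p ∣ ≡ suc ∣ p - x ∣
  ∣p∣≡1+∣p-x∣ {p = inside  ∷ p} here          = cong suc (cong ∣_∣ (sym (p─⊥≡p p)))
  ∣p∣≡1+∣p-x∣ {p = inside  ∷ p} (there x∈p) = cong suc (∣p∣≡1+∣p-x∣ x∈p)
  ∣p∣≡1+∣p-x∣ {p = outside ∷ p} (there x∈p) = ∣p∣≡1+∣p-x∣ x∈p

  ∣p∪⁅x⁆∣≡1+∣p∣ : x ∉ p → ∣ p ∪ ⁅ x ⁆ ∣ ≡ suc ∣ p ∣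
  ∣p∪⁅x⁆∣≡1+∣p∣ {x = zero} {p = inside  ∷ p}  x∉p = contradiction here x∉p
  ∣p∪⁅x⁆∣≡1+∣p∣ {x = zero} {p = outside ∷ p}  _   = cong (suc ∘ ∣_∣) (∪-identityʳ p)
  ∣p∪⁅x⁆∣≡1+∣p∣ {x = suc x} {p = inside  ∷ p} x∉p = cong suc (∣p∪⁅x⁆∣≡1+∣p∣ (x∉p ∘ there))
  ∣p∪⁅x⁆∣≡1+∣p∣ {x = suc x} {p = outside ∷ p} x∉p = ∣p∪⁅x⁆∣≡1+∣p∣ (x∉p ∘ there)

  ∣p-x∪⁅y⁆∣≡∣p∣ : x ∈ p → y ∉ p - x → ∣ (p - x) ∪ ⁅ y ⁆ ∣ ≡ ∣ p ∣
  ∣p-x∪⁅y⁆∣≡∣p∣ x∈p y∉p-x = trans (∣p∪⁅x⁆∣≡1+∣p∣ y∉p-x) (sym (∣p∣≡1+∣p-x∣ x∈p))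

  p⊈q⇒∃∈∉ : p ⊈ q → ∃[ x ] (x ∈ p × x ∉ q)
  p⊈q⇒∃∈∉ {n} {p} {q} p⊈q =
    let x , x∈p⇏x∈q = ¬∀⟶∃¬ n _ (λ x → x ∈? p →-dec x ∈? q) (λ p⊆q → p⊈q (p⊆q _))
    in x , decidable-stable (x ∈? p) (λ x∉p → x∈p⇏x∈q (λ x∈p → contradiction x∈p x∉p))
         , x∈p⇏x∈q ∘ const

  ∣p∣<∣q∣⇒∃∈∉ : ∣ p ∣ < ∣ q ∣ → ∃[ x ] (x ∈ q × x ∉ p)
  ∣p∣<∣q∣⇒∃∈∉ ∣p∣<∣q∣ = p⊈q⇒∃∈∉ λ q⊆p → <⇒≱ ∣p∣<∣q∣ (p⊆q⇒∣p∣≤∣q∣ q⊆p)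

  0<∣p∣⇒Nonempty : 0 < ∣ p ∣ → Nonempty p
  0<∣p∣⇒Nonempty {n} {p} 0<∣p∣ =
    let x , x∈p , _ = ∣p∣<∣q∣⇒∃∈∉ {p = ⊥} (subst (_< ∣ p ∣) (sym (∣⊥∣≡0 n)) 0<∣p∣)
    in x , x∈p

  2≤∣p∣⇒∃≢ : 2 ≤ ∣ p ∣ → ∃₂ λ x y → x ∈ p × y ∈ p × x ≢ y
  2≤∣p∣⇒∃≢ {p = p} 2≤∣p∣ =
    let x , x∈p = 0<∣p∣⇒Nonempty (≤-trans (s≤s z≤n) 2≤∣p∣)
        y , y∈p , y∉⁅x⁆ = ∣p∣<∣q∣⇒∃∈∉ {p = ⁅ x ⁆} (subst (_< ∣ p ∣) (sym (∣⁅x⁆∣≡1 x)) 2≤∣p∣)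
    in x , y , x∈p , y∈p , x∉⁅y⁆⇒x≢y y∉⁅x⁆ ∘ sym

  ⊆-extend : {p : Subset n} (m : ℕ) → m ≤ n → ∣ p ∣ ≤ m → ∃[ q ] (p ⊆ q × ∣ q ∣ ≡ m)
  ⊆-extend {p = p} zero _ ∣p∣≤0 = p , id , n≤0⇒n≡0 ∣p∣≤0
  ⊆-extend {n = n} {p = p} (suc m) m<n ∣p∣≤1+m with m≤n⇒m<n∨m≡n ∣p∣≤1+m
  ... | inj₂ ∣p∣≡1+m = p , id , ∣p∣≡1+m
  ... | inj₁ ∣p∣<1+m =
    let q , p⊆q , ∣q∣≡m = ⊆-extend m (<⇒≤ m<n) (s≤s⁻¹ ∣p∣<1+m)
        x , _ , x∉q = ∣p∣<∣q∣⇒∃∈∉ {p = q} {q = ⊤} (subst₂ _<_ (sym ∣q∣≡m) (sym (∣⊤∣≡n n)) m<n)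
    in q ∪ ⁅ x ⁆ , (λ y∈p → p⊆p∪q ⁅ x ⁆ (p⊆q y∈p)) , trans (∣p∪⁅x⁆∣≡1+∣p∣ x∉q) (cong suc ∣q∣≡m)

  IsImage : (Fin n → Fin n) → Subset n → Subset n → Set
  IsImage f q p = ∀ y → (y ∈ q) ⇔ (∃[ x ] (x ∈ p × y ≡ f x))

  module _ {n : ℕ} {f : Fin n → Fin n} (f-injective : Injective _≡_ _≡_ f) where

    image-remove : IsImage f q p → x ∈ p → IsImage f (q - f x) (p - x)
    image-remove {q = q} {p} {x} q≡f[p] x∈p y = mk⇔ forth back
      where
      forth : y ∈ q - f x → ∃[ u ] (u ∈ p - x × y ≡ f u)
      forth y∈q-fx =
        let u , u∈p , y≡fu = to (q≡f[p] y) (x∈p-y⇒x∈p y∈q-fx)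
        in u , x∈p∧x≢y⇒x∈p-y u∈p (x∈p-y⇒x≢y y∈q-fx ∘ trans y≡fu ∘ cong f) , y≡fu
      back : ∃[ u ] (u ∈ p - x × y ≡ f u) → y ∈ q - f x
      back (u , u∈p-x , y≡fu) = subst (_∈ q - f x) (sym y≡fu)
        (x∈p∧x≢y⇒x∈p-y (from (q≡f[p] (f u)) (u , x∈p-y⇒x∈p u∈p-x , refl))
                        (x∈p-y⇒x≢y u∈p-x ∘ f-injective))

    ∣image∣ : IsImage f q p → ∣ q ∣ ≡ ∣ p ∣
    ∣image∣ {p = p} = count ∣ p ∣ refl
      where
      count : {p q : Subset n} (m : ℕ) → ∣ p ∣ ≡ m → IsImage f q p → ∣ q ∣ ≡ m
      count {p} {q} zero ∣p∣≡0 q≡f[p] = trans (cong ∣_∣ (Empty-unique q-empty)) (∣⊥∣≡0 n)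
        where
        q-empty : Empty q
        q-empty (y , y∈q) =
          let x , x∈p , _ = to (q≡f[p] y) y∈q
          in 0≢1+n (trans (sym ∣p∣≡0) (∣p∣≡1+∣p-x∣ x∈p))
      count {p} {q} (suc m) ∣p∣≡1+m q≡f[p] =
        let x , x∈p = 0<∣p∣⇒Nonempty (subst (0 <_) (sym ∣p∣≡1+m) z<s)
            ∣p-x∣≡m = suc-injective (trans (sym (∣p∣≡1+∣p-x∣ x∈p)) ∣p∣≡1+m)
        in trans (∣p∣≡1+∣p-x∣ (from (q≡f[p] (f x)) (x , x∈p , refl)))
                 (cong suc (count m ∣p-x∣≡m (image-remove q≡f[p] x∈p)))

open Cardinality

module Translation {n : ℕ} {_+_ : Op₂ (Fin n)} {0# : Fin n} { -_ : Op₁ (Fin n)}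
                   (isAbelianGroup : IsAbelianGroup _≡_ _+_ 0# -_) where

  open IsAbelianGroup isAbelianGroup using (isGroup; assoc; identityʳ)
  open IsGroup isGroup public using (_//_)

  abelianGroup : AbelianGroup 0ℓ 0ℓ
  abelianGroup = record
    { Carrier = Fin n ; _≈_ = _≡_ ; _∙_ = _+_ ; ε = 0# ; _⁻¹ = -_
    ; isAbelianGroup = isAbelianGroup }

  open AbelianGroupProperties abelianGroup
    using (//-rightDividesˡ; //-rightDividesʳ; \\-leftDividesʳ; ∙-cancelˡ; ∙-cancelʳ;
           ⁻¹-injective; ⁻¹-involutive; ⁻¹-anti-homo-//; ε⁻¹≈ε)

  //-cancelʳ : ∀ {x y} a → x // a ≡ y // a → x ≡ y
  //-cancelʳ {x} {y} a = ∙-cancelʳ (- a) x y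

  //-cancelˡ : ∀ x {a b} → x // a ≡ x // b → a ≡ b
  //-cancelˡ x {a} {b} = ⁻¹-injective ∘ ∙-cancelˡ x (- a) (- b)

  x//0#≡x : ∀ x → x // 0# ≡ x
  x//0#≡x x = trans (cong (x +_) ε⁻¹≈ε) (identityʳ x)

  x+x≡x⇒x≡0# : ∀ {x} → x + x ≡ x → x ≡ 0#
  x+x≡x⇒x≡0# {x} x+x≡x = ∙-cancelˡ x x 0# (trans x+x≡x (sym (identityʳ x)))

  [x//a]//[y//a]≡x//y : ∀ x y a → (x // a) // (y // a) ≡ x // y
  [x//a]//[y//a]≡x//y x y a = begin
    (x // a) // (y // a)   ≡⟨ cong ((x // a) +_) (⁻¹-anti-homo-// y a) ⟩
    (x // a) + (a // y)    ≡⟨ assoc x (- a) (a // y) ⟩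
    x + ((- a) + (a // y)) ≡⟨ cong (x +_) (\\-leftDividesʳ a (- y)) ⟩
    x // y                 ∎
    where open ≡-Reasoning

  x//[b//a]≡[x+a]//b : ∀ x a b → x // (b // a) ≡ (x + a) // b
  x//[b//a]≡[x+a]//b x a b = begin
    x // (b // a)  ≡⟨ cong (x +_) (⁻¹-anti-homo-// b a) ⟩
    x + (a // b)   ≡⟨ sym (assoc x a (- b)) ⟩
    (x + a) // b   ∎
    where open ≡-Reasoning

  _⊕_ : Subset n → Fin n → Subset n
  p ⊕ a = tabulate (λ y → lookup p (y // a))

  x∈p⊕a⇔x//a∈p : ∀ {x p a} → (x ∈ p ⊕ a) ⇔ (x // a ∈ p)
  x∈p⊕a⇔x//a∈p {x} {p} {a} = mk⇔
    (λ x∈p⊕a → lookup⇒[]= (x // a) p (trans (sym (lookup∘tabulate _ x)) ([]=⇒lookup x∈p⊕a)))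
    (λ x//a∈p → lookup⇒[]= x (p ⊕ a) (trans (lookup∘tabulate _ x) ([]=⇒lookup x//a∈p)))

  x+a∈p⊕a⇔x∈p : ∀ {x p a} → (x + a ∈ p ⊕ a) ⇔ (x ∈ p)
  x+a∈p⊕a⇔x∈p {x} {p} {a} = mk⇔
    (subst (_∈ p) (//-rightDividesʳ a x) ∘ to x∈p⊕a⇔x//a∈p)
    (from x∈p⊕a⇔x//a∈p ∘ subst (_∈ p) (sym (//-rightDividesʳ a x)))

  x∈p⊕[-a]⇔x+a∈p : ∀ {x p a} → (x ∈ p ⊕ (- a)) ⇔ (x + a ∈ p)
  x∈p⊕[-a]⇔x+a∈p {x} {p} {a} = mk⇔
    (subst (_∈ p) x//[-a]≡x+a ∘ to x∈p⊕a⇔x//a∈p)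
    (from x∈p⊕a⇔x//a∈p ∘ subst (_∈ p) (sym x//[-a]≡x+a))
    where
    x//[-a]≡x+a : x // (- a) ≡ x + a
    x//[-a]≡x+a = cong (x +_) (⁻¹-involutive a)

  translate⊆⇔⊆⊕ : ∀ {X p a} → (∃[ T ] (T ⊆ p × IsTranslateOf _+_ X a T)) ⇔ (X ⊆ p ⊕ a)
  translate⊆⇔⊆⊕ {X} {p} {a} = mk⇔ ⊆⊕ translate
    where
    ⊆⊕ : ∃[ T ] (T ⊆ p × IsTranslateOf _+_ X a T) → X ⊆ p ⊕ a
    ⊆⊕ (T , T⊆p , X≡T+a) {y} y∈X =
      let s , s∈T , y≡s+a = to (X≡T+a y) y∈X
      in subst (_∈ p ⊕ a) (sym y≡s+a) (from x+a∈p⊕a⇔x∈p (T⊆p s∈T))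
    translate : X ⊆ p ⊕ a → ∃[ T ] (T ⊆ p × IsTranslateOf _+_ X a T)
    translate X⊆p⊕a = X ⊕ (- a) , T⊆p , X≡T+a
      where
      T⊆p : X ⊕ (- a) ⊆ p
      T⊆p s∈T = to x+a∈p⊕a⇔x∈p (X⊆p⊕a (to x∈p⊕[-a]⇔x+a∈p s∈T))
      X≡T+a : IsTranslateOf _+_ X a (X ⊕ (- a))
      X≡T+a y = mk⇔
        (λ y∈X → y // a
               , from x∈p⊕[-a]⇔x+a∈p (subst (_∈ X) (sym (//-rightDividesˡ a y)) y∈X)
               , sym (//-rightDividesˡ a y))
        (λ (s , s∈T , y≡s+a) → subst (_∈ X) (sym y≡s+a) (to x∈p⊕[-a]⇔x+a∈p s∈T))

  translate-⊆⊕ : ∀ {X Y p a b} → IsTranslateOf _+_ Y a X → Y ⊆ p ⊕ b → X ⊆ p ⊕ (b // a)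
  translate-⊆⊕ {X} {Y} {p} {a} {b} Y≡X+a Y⊆p⊕b {x} x∈X =
    from x∈p⊕a⇔x//a∈p (subst (_∈ p) (sym (x//[b//a]≡[x+a]//b x a b)) [x+a]//b∈p)
    where
    [x+a]//b∈p : (x + a) // b ∈ p
    [x+a]//b∈p = to x∈p⊕a⇔x//a∈p (Y⊆p⊕b (from (Y≡X+a (x + a)) (x , x∈X , refl)))

  ∣translate∣ : ∀ {X Y a} → IsTranslateOf _+_ Y a X → ∣ Y ∣ ≡ ∣ X ∣
  ∣translate∣ {a = a} = ∣image∣ (∙-cancelʳ a _ _)

module DistinctDifferenceSystem
  {n l : ℕ} {_+_ : Op₂ (Fin n)} {0# : Fin n} { -_ : Op₁ (Fin n)}
  (isAbelianGroup : IsAbelianGroup _≡_ _+_ 0# -_)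
  {S : Fin l → Subset n} (dds : IsDistinctDifferenceSystem _+_ 0# -_ S) where

  open Translation isAbelianGroup
  open AbelianGroupProperties abelianGroup using (//-rightDividesʳ)

  InBlockTranslate : Subset n → Set
  InBlockTranslate X = ∃[ i ] ∃[ a ] X ⊆ S i ⊕ a

  inBlockTranslate? : ∀ X → Dec (InBlockTranslate X)
  inBlockTranslate? X = any? λ i → any? λ a → X ⊆? S i ⊕ a

  ⊆-inBlockTranslate : ∀ {X Y} → X ⊆ Y → InBlockTranslate Y → InBlockTranslate X
  ⊆-inBlockTranslate X⊆Y (i , a , Y⊆) = i , a , Y⊆ ∘ X⊆Y

  isDDSBasis⁺ : ∀ {k X} → ∣ X ∣ ≡ k → ¬ InBlockTranslate X → IsDDSBasis _+_ S k X
  isDDSBasis⁺ ∣X∣≡k ¬X∈ = ∣X∣≡k , λ (i , a , X≡T+a) → ¬X∈ (i , a , to translate⊆⇔⊆⊕ X≡T+a)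

  isDDSBasis⁻ : ∀ {k X} → IsDDSBasis _+_ S k X → ¬ InBlockTranslate X
  isDDSBasis⁻ (_ , ¬X≡T+a) (i , a , X⊆) = ¬X≡T+a (i , a , from translate⊆⇔⊆⊕ X⊆)

  blockTranslate-unique : ∀ {x y i j a b} → x ≢ y →
    x ∈ S i ⊕ a → y ∈ S i ⊕ a → x ∈ S j ⊕ b → y ∈ S j ⊕ b → i ≡ j × a ≡ b
  blockTranslate-unique {x} {y} {i} {j} {a} {b} x≢y x∈Sᵢ+a y∈Sᵢ+a x∈Sⱼ+b y∈Sⱼ+b =
    i≡j , //-cancelˡ x (proj₁ same-points)
    where
    x-a∈Sᵢ : x // a ∈ S i
    x-a∈Sᵢ = to x∈p⊕a⇔x//a∈p x∈Sᵢ+a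
    y-a∈Sᵢ : y // a ∈ S i
    y-a∈Sᵢ = to x∈p⊕a⇔x//a∈p y∈Sᵢ+a
    x-b∈Sⱼ : x // b ∈ S j
    x-b∈Sⱼ = to x∈p⊕a⇔x//a∈p x∈Sⱼ+b
    y-b∈Sⱼ : y // b ∈ S j
    y-b∈Sⱼ = to x∈p⊕a⇔x//a∈p y∈Sⱼ+b
    same-points : x // a ≡ x // b × y // a ≡ y // b
    same-points = proj₁ dds i j _ _ _ _ x-a∈Sᵢ y-a∈Sᵢ x-b∈Sⱼ y-b∈Sⱼ
      (x≢y ∘ //-cancelʳ a) (x≢y ∘ //-cancelʳ b)
      (trans ([x//a]//[y//a]≡x//y x y a) (sym ([x//a]//[y//a]≡x//y x y b)))
    i≡j : i ≡ j
    i≡j = decidable-stable (i ≟ j) λ i≢j →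
      let in-both : ∀ {u} → u // a ∈ S i → u // b ∈ S j → u // a ≡ u // b → u // a ≡ 0#
          in-both u-a∈Sᵢ u-b∈Sⱼ eq =
            proj₂ (proj₂ dds) i j i≢j _ u-a∈Sᵢ (subst (_∈ S j) (sym eq) u-b∈Sⱼ)
      in x≢y (//-cancelʳ a (trans (in-both x-a∈Sᵢ x-b∈Sⱼ (proj₁ same-points))
                                  (sym (in-both y-a∈Sᵢ y-b∈Sⱼ (proj₂ same-points)))))

  ∃∉block : ∀ i → ∃[ z ] z ∉ S i
  ∃∉block i =
    let 0∈Sᵢ , g , g∈Sᵢ , g≢0 = proj₁ (proj₂ dds) i
        2g≢g : g + g ≢ g
        2g≢g = g≢0 ∘ x+x≡x⇒x≡0#
    in g + g , λ 2g∈Sᵢ → 2g≢g (sym (proj₁ (proj₁ dds i i g 0# (g + g) g g∈Sᵢ 0∈Sᵢ 2g∈Sᵢ g∈Sᵢ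
         g≢0 2g≢g (trans (x//0#≡x g) (sym (//-rightDividesʳ g g))))))

  ∃∉blockTranslate : ∀ i a → ∃[ z ] z ∉ S i ⊕ a
  ∃∉blockTranslate i a = let z , z∉Sᵢ = ∃∉block i in z + a , z∉Sᵢ ∘ to x+a∈p⊕a⇔x∈p

  ¬inBlockTranslate-∪⁅⁆ : ∀ {X i a z} → 2 ≤ ∣ X ∣ → X ⊆ S i ⊕ a → z ∉ S i ⊕ a →
                          ¬ InBlockTranslate (X ∪ ⁅ z ⁆)
  ¬inBlockTranslate-∪⁅⁆ {X} {z = z} 2≤∣X∣ X⊆Sᵢ+a z∉Sᵢ+a (j , b , X∪z⊆Sⱼ+b)
    with x , y , x∈X , y∈X , x≢y ← 2≤∣p∣⇒∃≢ 2≤∣X∣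
    with refl , refl ← blockTranslate-unique x≢y (X⊆Sᵢ+a x∈X) (X⊆Sᵢ+a y∈X)
                         (X∪z⊆Sⱼ+b (p⊆p∪q _ x∈X)) (X∪z⊆Sⱼ+b (p⊆p∪q _ y∈X))
    = z∉Sᵢ+a (X∪z⊆Sⱼ+b (q⊆p∪q X ⁅ z ⁆ (x∈⁅x⁆ z)))

module DDSMatroid
  {k n l : ℕ} {_+_ : Op₂ (Fin n)} {0# : Fin n} { -_ : Op₁ (Fin n)}
  (isAbelianGroup : IsAbelianGroup _≡_ _+_ 0# -_)
  {S : Fin l → Subset n} (dds : IsDistinctDifferenceSystem _+_ 0# -_ S)
  (3≤k : 3 ≤ k) (k≤n : k ≤ n) where

  open import Data.Fin.Subset using (_-_)
  open Translation isAbelianGroup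
  open DistinctDifferenceSystem isAbelianGroup dds

  Basis : Subset n → Set
  Basis = IsDDSBasis _+_ S k

  swap-into-basis : ∀ {B x i a z} → ∣ B ∣ ≡ k → x ∈ B → B - x ⊆ S i ⊕ a → z ∉ S i ⊕ a →
                    Basis ((B - x) ∪ ⁅ z ⁆)
  swap-into-basis {B} {x} ∣B∣≡k x∈B B-x⊆Sᵢ+a z∉Sᵢ+a =
    isDDSBasis⁺ (trans (∣p-x∪⁅y⁆∣≡∣p∣ x∈B (z∉Sᵢ+a ∘ B-x⊆Sᵢ+a)) ∣B∣≡k)
                (¬inBlockTranslate-∪⁅⁆ 2≤∣B-x∣ B-x⊆Sᵢ+a z∉Sᵢ+a)
    where
    2≤∣B-x∣ : 2 ≤ ∣ B - x ∣
    2≤∣B-x∣ = s≤s⁻¹ (subst (3 ≤_) (trans (sym ∣B∣≡k) (∣p∣≡1+∣p-x∣ x∈B)) 3≤k)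

  small-independent : ∀ {C} → ∣ C ∣ ≤ 2 → Independent Basis C
  small-independent {C} ∣C∣≤2
    with X , C⊆X , ∣X∣≡k ← ⊆-extend k k≤n (<⇒≤ (≤-<-trans ∣C∣≤2 3≤k))
    with inBlockTranslate? X
  ... | no ¬X∈ = X , isDDSBasis⁺ ∣X∣≡k ¬X∈ , C⊆X
  ... | yes (i , a , X⊆Sᵢ+a) =
    let z , z∉Sᵢ+a = ∃∉blockTranslate i a
        w , w∈X , w∉C = ∣p∣<∣q∣⇒∃∈∉ (subst (∣ C ∣ <_) (sym ∣X∣≡k) (≤-<-trans ∣C∣≤2 3≤k))
        C⊆X-w∪z : C ⊆ (X - w) ∪ ⁅ z ⁆
        C⊆X-w∪z c∈C = p⊆p∪q ⁅ z ⁆ (x∈p∧x≢y⇒x∈p-y (C⊆X c∈C) (x∈p∧y∉p⇒x≢y c∈C w∉C))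
    in (X - w) ∪ ⁅ z ⁆ , swap-into-basis ∣X∣≡k w∈X (X⊆Sᵢ+a ∘ x∈p-y⇒x∈p) z∉Sᵢ+a , C⊆X-w∪z

  exchange : ∀ B₁ B₂ x → Basis B₁ → Basis B₂ → x ∈ B₁ → x ∉ B₂ →
             ∃[ y ] (y ∈ B₂ × y ∉ B₁ × Basis ((B₁ - x) ∪ ⁅ y ⁆))
  exchange B₁ B₂ x B₁-basis@(∣B₁∣≡k , _) B₂-basis@(∣B₂∣≡k , _) x∈B₁ x∉B₂
    with inBlockTranslate? (B₁ - x)
  ... | yes (i , a , B₁-x⊆Sᵢ+a) =
    let y , y∈B₂ , y∉Sᵢ+a = p⊈q⇒∃∈∉ λ B₂⊆Sᵢ+a → isDDSBasis⁻ B₂-basis (i , a , B₂⊆Sᵢ+a)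
    in y , y∈B₂ , x≢y∧x∉p-y⇒x∉p (x∈p∧y∉p⇒x≢y y∈B₂ x∉B₂) (y∉Sᵢ+a ∘ B₁-x⊆Sᵢ+a)
         , swap-into-basis ∣B₁∣≡k x∈B₁ B₁-x⊆Sᵢ+a y∉Sᵢ+a
  ... | no ¬B₁-x∈ =
    let y , y∈B₂ , y∉B₁-x = ∣p∣<∣q∣⇒∃∈∉ ∣B₁-x∣<∣B₂∣
    in y , y∈B₂ , x≢y∧x∉p-y⇒x∉p (x∈p∧y∉p⇒x≢y y∈B₂ x∉B₂) y∉B₁-x
         , isDDSBasis⁺ (trans (∣p-x∪⁅y⁆∣≡∣p∣ x∈B₁ y∉B₁-x) ∣B₁∣≡k)
                       (¬B₁-x∈ ∘ ⊆-inBlockTranslate (p⊆p∪q _))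
    where
    ∣B₁-x∣<∣B₂∣ : ∣ B₁ - x ∣ < ∣ B₂ ∣
    ∣B₁-x∣<∣B₂∣ = ≤-reflexive (trans (sym (∣p∣≡1+∣p-x∣ x∈B₁)) (trans ∣B₁∣≡k (sym ∣B₂∣≡k)))

  isMatroidBases : IsMatroidBases Basis
  isMatroidBases =
    let B , B-basis , _ = small-independent {⊥} (subst (_≤ 2) (sym (∣⊥∣≡0 n)) z≤n)
    in (B , B-basis) , exchange

  simple : IsSimple Basis
  simple C (dependent , _) = ≰⇒> (dependent ∘ small-independent)

  translationInvariant : IsTranslationInvariant _+_ Basis
  translationInvariant B a Y B-basis@(∣B∣≡k , _) Y≡B+a =
    isDDSBasis⁺ (trans (∣translate∣ Y≡B+a) ∣B∣≡k)
      λ (i , b , Y⊆Sᵢ+b) → isDDSBasis⁻ B-basis (i , b // a , translate-⊆⊕ {p = S i} Y≡B+a Y⊆Sᵢ+b)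

theorem3p26 : (k n l : ℕ) → 3 ≤ k → k ≤ n →
    (_+_ : Op₂ (Fin n)) (0# : Fin n) (-_ : Op₁ (Fin n)) →
    IsAbelianGroup _≡_ _+_ 0# -_ →
    (S : Fin l → Subset n) → IsDistinctDifferenceSystem _+_ 0# -_ S →
    IsMatroidBases (IsDDSBasis _+_ S k)
    × HasRank (IsDDSBasis _+_ S k) k
    × IsSimple (IsDDSBasis _+_ S k)
    × IsTranslationInvariant _+_ (IsDDSBasis _+_ S k)
theorem3p26 k n l 3≤k k≤n _+_ 0# -_ isAbelianGroup S dds =
  isMatroidBases , (λ _ → proj₁) , simple , translationInvariant
  where open DDSMatroid isAbelianGroup dds 3≤k k≤n
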